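{- Let $n\ge0$, let $\pi$ be an up-down permutation of $[n+1]$, and let $\sigma=\varphi(\pi)$. Then $c_e(\sigma)=\mathrm{lrm}(\pi)-1$, $c_o(\sigma)=\mathrm{st}(\pi)-1$, and $c(\sigma)=\mathrm{lrm}(\pi)+\mathrm{st}(\pi)-2$.
   Context: For a finite set $A=\{a_1<\dots<a_r\}$ of positive integers and a word $\sigma$ that is a permutation of $A$, the switch $\overline{\sigma}$ replaces each entry $a_i$ by $a_{r+1-i}$. An up-down arrangement is $\pi_1\pi_2\cdots$ with $\pi_1<\pi_2>\pi_3<\cdots$. An entry $\pi_i$ of a word is a left-to-right (LR) minimum if $\pi_i<\pi_j$ for all $j<i$; $\mathrm{lrm}(\pi)$ is their number. For a word $\tau=\tau_1\cdots\tau_r$ of distinct integers with LR minima at positions $i_1<\dots<i_k$, let $g(\tau)=(\tau_{i_1},\dots,\tau_{i_2-1})\cdots(\tau_{i_k},\dots,\tau_r)$ (product of disjoint cycles; $g$ of the empty word is the empty product). The map $f$ on up-down arrangements of a finite set $A$ is defined recursively: $f(\text{empty})$ is the empty product, and if $\pi_k=\min A$ then $f(\pi)=(\pi_k,\pi_{k-1},\dots,\pi_1)\,f(\overline{\pi_{k+1}\cdots\pi_r})$. For an up-down permutation $\pi$ of $[n+1]$ with $\pi_k=1$, set $\pi'_i=\pi_i-1$ and define $\varphi(\pi)$ to be the permutation of $[n]$ with cycle decomposition $g(\pi'_1\cdots\pi'_{k-1})\,f(\overline{\pi'_{k+1}\cdots\pi'_{n+1}})$. The min-max subsequence of $\pi=\pi_1\cdots\pi_r$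 is $\pi_{i_1}\pi_{i_2}\cdots\pi_{i_k}$ where $\pi_{i_1}$ is the smallest entry, $\pi_{i_2}$ the largest entry to the right of position $i_1$, $\pi_{i_3}$ the smallest entry to the right of position $i_2$, etc., until $i_k=r$; $\mathrm{st}(\pi)=k$. For a permutation $\sigma$, $c(\sigma)$, $c_o(\sigma)$, $c_e(\sigma)$ denote the numbers of cycles, odd-length cycles and even-length cycles. -}

module Defs where

open import Data.Nat using (ℕ; zero; suc; _+_; _∸_; _<ᵇ_; _≤ᵇ_; _≡ᵇ_; _<_)
open import Data.Bool using (Bool; true; false; if_then_else_; _∧_; not)
open import Data.List using (List; []; _∷_; _++_; map; length; reverse; filter; upTo; foldr)
open import Data.Product using (_×_; _,_; proj₁; proj₂)
open import Data.Unit using (⊤)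
open import Data.Empty using (⊥)

-- Words are lists of natural numbers; permutations of [m] are lists
-- containing 1,…,m each exactly once (one-line notation).

oneTo : ℕ → List ℕ
oneTo m = map suc (upTo m)

countB : {A : Set} → (A → Bool) → List A → ℕ
countB p [] = 0
countB p (x ∷ xs) = (if p x then 1 else 0) + countB p xs

allB : {A : Set} → (A → Bool) → List A → Bool
allB p [] = true
allB p (x ∷ xs) = p x ∧ allB p xs

T : Bool → Set
T true = ⊤
T false = ⊥

mutual
  UpFrom : ℕ → List ℕ → Set
  UpFrom a [] = ⊤
  UpFrom a (b ∷ w) = (a < b) × DownFrom b w

  DownFrom : ℕ → List ℕ → Set
  DownFrom a [] = ⊤
  DownFrom a (b ∷ w) = (b < a) × UpFrom b w

UpDown : List ℕ → Set
UpDown [] = ⊤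
UpDown (a ∷ w) = UpFrom a w

-- switch: a_i ↦ a_{r+1-i}.  The image of x is the entry y of the word
-- with #{z > y} = #{z < x}  (both equal i-1 when x = a_i, y = a_{r+1-i}).

pickGreater : List ℕ → ℕ → List ℕ → ℕ
pickGreater w k [] = 0
pickGreater w k (y ∷ ys) =
  if countB (λ z → y <ᵇ z) w ≡ᵇ k then y else pickGreater w k ys

switch : List ℕ → List ℕ
switch w = map (λ x → pickGreater w (countB (λ z → z <ᵇ x) w) w) w

lrmFrom : ℕ → List ℕ → ℕ
lrmFrom m [] = 0
lrmFrom m (x ∷ xs) = if x <ᵇ m then suc (lrmFrom x xs) else lrmFrom m xs

lrm : List ℕ → ℕ
lrm [] = 0
lrm (x ∷ xs) = suc (lrmFrom x xs)

-- g(τ): cut τ before every LR minimum; each block is a cycle.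
-- gAux m cur τ : m = current LR minimum, cur = current block (reversed).

gAux : ℕ → List ℕ → List ℕ → List (List ℕ)
gAux m cur [] = reverse cur ∷ []
gAux m cur (x ∷ xs) =
  if x <ᵇ m then reverse cur ∷ gAux x (x ∷ []) xs
  else gAux m (x ∷ cur) xs

g : List ℕ → List (List ℕ)
g [] = []
g (x ∷ xs) = gAux x (x ∷ []) xs

minFrom : ℕ → List ℕ → ℕ
minFrom m [] = m
minFrom m (x ∷ xs) = minFrom (if x <ᵇ m then x else m) xs

maxFrom : ℕ → List ℕ → ℕ
maxFrom m [] = m
maxFrom m (x ∷ xs) = maxFrom (if m <ᵇ x then x else m) xs

splitAtVal : ℕ → List ℕ → List ℕ × List ℕ
splitAtVal v [] = [] , []
splitAtVal v (x ∷ xs) =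
  if x ≡ᵇ v then ([] , xs)
  else (x ∷ proj₁ (splitAtVal v xs) , proj₂ (splitAtVal v xs))

-- f(π) = (π_k, π_{k-1}, …, π_1) f(switch(π_{k+1}⋯π_r)), π_k = min.
-- Recursion by fuel; fuel = length suffices (switch preserves length).

fFuel : ℕ → List ℕ → List (List ℕ)
fFuel zero w = []
fFuel (suc fuel) [] = []
fFuel (suc fuel) (x ∷ xs) =
  let m = minFrom x xs
      p = splitAtVal m (x ∷ xs)
  in reverse (proj₁ p ++ (m ∷ [])) ∷ fFuel fuel (switch (proj₂ p))

f : List ℕ → List (List ℕ)
f w = fFuel (length w) w

φCycles : List ℕ → List (List ℕ)
φCycles π =
  let π' = map (λ x → x ∸ 1) π
      p  = splitAtVal 0 π'
  in g (proj₁ p) ++ f (switch (proj₂ p))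

nextIn : ℕ → ℕ → List ℕ → ℕ → ℕ     -- first element, x, rest of cycle, default
nextIn first x [] d = d
nextIn first x (y ∷ []) d = if y ≡ᵇ x then first else d
nextIn first x (y ∷ z ∷ ys) d = if y ≡ᵇ x then z else nextIn first x (z ∷ ys) d

applyCycle : List ℕ → ℕ → ℕ
applyCycle [] x = x
applyCycle (c ∷ cs) x = nextIn c x (c ∷ cs) x

applyCycles : List (List ℕ) → ℕ → ℕ
applyCycles [] x = x
applyCycles (c ∷ cs) x = applyCycle c (applyCycles cs x)

φ : List ℕ → (ℕ → ℕ)
φ π = applyCycles (φCycles π)

iter : (ℕ → ℕ) → ℕ → ℕ → ℕ
iter σ zero x = x
iter σ (suc k) x = σ (iter σ k x)

-- length of the cycle of x : least k ∈ {1,…,n} with σ^k x = x (0 if none)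
cycleLenSearch : (ℕ → ℕ) → ℕ → List ℕ → ℕ
cycleLenSearch σ x [] = 0
cycleLenSearch σ x (k ∷ ks) = if iter σ k x ≡ᵇ x then k else cycleLenSearch σ x ks

cycleLen : (ℕ → ℕ) → ℕ → ℕ → ℕ
cycleLen σ n x = cycleLenSearch σ x (oneTo n)

-- x is the least element of its cycle (cycle has ≤ n elements)
isCycleMin : (ℕ → ℕ) → ℕ → ℕ → Bool
isCycleMin σ n x = allB (λ j → x ≤ᵇ iter σ j x) (oneTo n)

even? : ℕ → Bool
even? zero = true
even? (suc k) = not (even? k)

cyc : ℕ → (ℕ → ℕ) → ℕ
cyc n σ = countB (isCycleMin σ n) (oneTo n)

cycE : ℕ → (ℕ → ℕ) → ℕ
cycE n σ = countB (λ x → isCycleMin σ n x ∧ even? (cycleLen σ n x)) (oneTo n)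

cycO : ℕ → (ℕ → ℕ) → ℕ
cycO n σ = countB (λ x → isCycleMin σ n x ∧ not (even? (cycleLen σ n x))) (oneTo n)

mutual
  stMin : ℕ → List ℕ → ℕ
  stMin zero w = 0
  stMin (suc fuel) [] = 0
  stMin (suc fuel) (x ∷ xs) with proj₂ (splitAtVal (minFrom x xs) (x ∷ xs))
  ... | [] = 1
  ... | r ∷ rs = suc (stMax fuel (r ∷ rs))

  stMax : ℕ → List ℕ → ℕ
  stMax zero w = 0
  stMax (suc fuel) [] = 0
  stMax (suc fuel) (x ∷ xs) with proj₂ (splitAtVal (maxFrom x xs) (x ∷ xs))
  ... | [] = 1
  ... | r ∷ rs = suc (stMin fuel (r ∷ rs))

st : List ℕ → ℕ
st w = stMin (length w) w

module Submission where

-- Write π' = π − 1 = p ++ 0 ∷ s.  By definition φ(π) is the product of the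
-- cycles  g(p) ++ f(switch s),  and the proof studies the two halves apart.
--
-- If a list of nonempty cycles
--   cs has  concat cs ↭ [1..n],  then the cycle of each x under
--   applyCycles cs is the cycle of cs containing x, so cyc/cycE/cycO just
--   count the cycles of cs (resp. the even/odd ones).
-- * g(p): the blocks of p cut before each LR minimum.  Since π' is up-down
--   and every LR minimum of p is a descent bottom, every block has even
--   length; there are lrm p = lrm π − 1 of them.
-- * f(w) for an up-down w: the first cycle ends at the minimum of w, which
--   sits at an odd position, so it has odd length; switch is an
--   order-reversing bijection of the remaining suffix, which is down-up,
--   so switch of it is again up-down and the recursion continues.  Since
--   switch exchanges minima and maxima, the number of cycles of f(switch s)
--   equals the length of the min-max subsequence of s, i.e. st π − 1.

open import Defs
open import Data.Nat using (ℕ; zero; suc; _∸_; _+_; _<_; _≤_; z≤n; s≤s; _<ᵇ_; _≤ᵇ_; _≡ᵇ_)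
open import Data.Nat.Properties
open import Data.Bool using (Bool; true; false; if_then_else_; _∧_; not)
import Data.Bool as Bool
open import Data.Bool.Properties using (T-≡; ¬-not)
open import Data.List using (List; []; _∷_; _++_; map; length; reverse; concat; applyUpTo; [_])
open import Data.List.Properties
  using (length-++; length-map; concat-++; length-reverse; ++-assoc; unfold-reverse)
open import Data.List.Membership.Propositional using (_∈_; _∉_)
open import Data.List.Membership.Propositional.Properties using (∈-++⁺ˡ; ∈-++⁺ʳ; ∈-++⁻; ∈-∃++; ∈-map⁻)
open import Data.List.Relation.Unary.Any using (here; there)
open import Data.List.Relation.Binary.Permutation.Propositional
  using (_↭_; ↭-refl; ↭-sym; ↭-trans; ↭-reflexive; prep; swap)
  renaming (refl to ↭-refl′; trans to ↭-trans′)
open import Data.List.Relation.Binary.Permutation.Propositional.Properties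
  using (∈-resp-↭; ++-comm; ↭-length; ++⁺ˡ; ++⁺ʳ; shift; drop-mid; ↭-reverse; map⁺)
open import Relation.Binary.PropositionalEquality hiding ([_])
open import Relation.Binary.Definitions using (tri<; tri≈; tri>)
open import Data.Product using (∃; ∃₂; _×_; _,_; proj₁; proj₂)
open import Data.Sum using (_⊎_; inj₁; inj₂)
open import Data.Empty using (⊥; ⊥-elim)
open import Data.Unit using (⊤; tt)
open import Function.Bundles using (Equivalence)

T⇒≡true : ∀ {b} → Bool.T b → b ≡ true
T⇒≡true = Equivalence.to T-≡

≡true⇒T : ∀ {b} → b ≡ true → Bool.T b
≡true⇒T = Equivalence.from T-≡

≢true⇒≡false : ∀ {b} → (b ≡ true → ⊥) → b ≡ false
≢true⇒≡false = ¬-not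

true≢false : true ≡ false → ⊥
true≢false ()

≡ᵇ-sound : ∀ m n → (m ≡ᵇ n) ≡ true → m ≡ n
≡ᵇ-sound m n e = ≡ᵇ⇒≡ m n (≡true⇒T e)

≡ᵇ-refl : ∀ m → (m ≡ᵇ m) ≡ true
≡ᵇ-refl m = T⇒≡true (≡⇒≡ᵇ m m refl)

≡ᵇ-complete : ∀ {m n} → m ≡ n → (m ≡ᵇ n) ≡ true
≡ᵇ-complete {m} refl = ≡ᵇ-refl m

≡ᵇ-false : ∀ m n → m ≢ n → (m ≡ᵇ n) ≡ false
≡ᵇ-false m n m≢n = ≢true⇒≡false (λ e → m≢n (≡ᵇ-sound m n e))

<ᵇ-sound : ∀ m n → (m <ᵇ n) ≡ true → m < n
<ᵇ-sound m n e = <ᵇ⇒< m n (≡true⇒T e)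

<ᵇ-complete : ∀ {m n} → m < n → (m <ᵇ n) ≡ true
<ᵇ-complete m<n = T⇒≡true (<⇒<ᵇ m<n)

<ᵇ-false-sound : ∀ m n → (m <ᵇ n) ≡ false → n ≤ m
<ᵇ-false-sound m n e = ≮⇒≥ (λ m<n → true≢false (trans (sym (<ᵇ-complete m<n)) e))

<ᵇ-false-complete : ∀ {m n} → n ≤ m → (m <ᵇ n) ≡ false
<ᵇ-false-complete n≤m = ≢true⇒≡false (λ e → <⇒≱ (<ᵇ-sound _ _ e) n≤m)

<ᵇ-irrefl : ∀ x → (x <ᵇ x) ≡ false
<ᵇ-irrefl x = <ᵇ-false-complete {x} {x} ≤-refl

≤ᵇ-sound : ∀ m n → (m ≤ᵇ n) ≡ true → m ≤ n
≤ᵇ-sound m n e = ≤ᵇ⇒≤ m n (≡true⇒T e)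

≤ᵇ-complete : ∀ {m n} → m ≤ n → (m ≤ᵇ n) ≡ true
≤ᵇ-complete {m} {n} m≤n = T⇒≡true {m ≤ᵇ n} (≤⇒≤ᵇ m≤n)

bool-ext : ∀ {a b : Bool} → (a ≡ true → b ≡ true) → (b ≡ true → a ≡ true) → a ≡ b
bool-ext {true} {true} _ _ = refl
bool-ext {false} {false} _ _ = refl
bool-ext {true} {false} ab _ = sym (ab refl)
bool-ext {false} {true} _ ba = ba refl

-- Lists without repetitions: ND xs says that each entry of xs is absent
-- from the rest of xs (the library's Unique, in a form that destructures
-- directly into the freshness of the head and the rest).

ND : List ℕ → Set
ND [] = ⊤
ND (x ∷ xs) = (x ∉ xs) × ND xs

ND-↭ : ∀ {xs ys} → xs ↭ ys → ND xs → ND ys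
ND-↭ ↭-refl′ nd = nd
ND-↭ (prep x p) (x∉ , nd) = (λ m → x∉ (∈-resp-↭ (↭-sym p) m)) , ND-↭ p nd
ND-↭ (swap x y p) (x∉ , y∉ , nd) =
  (λ { (here e) → x∉ (here (sym e)) ; (there m) → y∉ (∈-resp-↭ (↭-sym p) m) }) ,
  (λ m → x∉ (there (∈-resp-↭ (↭-sym p) m))) , ND-↭ p nd
ND-↭ (↭-trans′ p q) nd = ND-↭ q (ND-↭ p nd)

ND-++ˡ : ∀ xs {ys} → ND (xs ++ ys) → ND xs
ND-++ˡ [] nd = tt
ND-++ˡ (x ∷ xs) (x∉ , nd) = (λ m → x∉ (∈-++⁺ˡ m)) , ND-++ˡ xs nd

ND-++ʳ : ∀ xs {ys} → ND (xs ++ ys) → ND ys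
ND-++ʳ [] nd = nd
ND-++ʳ (x ∷ xs) (_ , nd) = ND-++ʳ xs nd

ND-++-disjoint : ∀ xs {ys} → ND (xs ++ ys) → ∀ {x} → x ∈ xs → x ∉ ys
ND-++-disjoint (x ∷ xs) (x∉ , nd) (here refl) m = x∉ (∈-++⁺ʳ xs m)
ND-++-disjoint (x ∷ xs) (_ , nd) (there i) m = ND-++-disjoint xs nd i m

ND-map : ∀ (h : ℕ → ℕ) w → ND w → (∀ x y → x ∈ w → y ∈ w → h x ≡ h y → x ≡ y) → ND (map h w)
ND-map h [] nd inj = tt
ND-map h (x ∷ w) (x∉ , nd) inj = hx∉ , ND-map h w nd (λ a b am bm → inj a b (there am) (there bm))
  where
    hx∉ : h x ∉ map h w
    hx∉ m with ∈-map⁻ h m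
    ... | y , ym , e = x∉ (subst (_∈ w) (sym (inj x y (here refl) (there ym) e)) ym)

ND-⊆-length⇒↭ : ∀ u v → ND u → (∀ x → x ∈ u → x ∈ v) → length v ≤ length u → u ↭ v
ND-⊆-length⇒↭ [] [] nd sub le = ↭-refl
ND-⊆-length⇒↭ [] (y ∷ v) nd sub ()
ND-⊆-length⇒↭ (x ∷ u) v (x∉ , nd) sub le with ∈-∃++ (sub x (here refl))
... | a , b , refl = ↭-trans (prep x u↭ab) (↭-sym (shift x a b))
  where
    sub′ : ∀ y → y ∈ u → y ∈ a ++ b
    sub′ y ym with ∈-++⁻ a (sub y (there ym))
    ... | inj₁ m = ∈-++⁺ˡ m
    ... | inj₂ (here refl) = ⊥-elim (x∉ ym)
    ... | inj₂ (there m) = ∈-++⁺ʳ a m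
    len-ab : length (a ++ x ∷ b) ≡ suc (length (a ++ b))
    len-ab = trans (length-++ a) (trans (+-suc (length a) (length b)) (cong suc (sym (length-++ a))))
    u↭ab : u ↭ a ++ b
    u↭ab = ND-⊆-length⇒↭ u (a ++ b) nd sub′ (≤-pred (subst (_≤ suc (length u)) len-ab le))

rangeFrom : ℕ → ℕ → List ℕ
rangeFrom a zero = []
rangeFrom a (suc k) = a ∷ rangeFrom (suc a) k

oneTo-range : ∀ n → oneTo n ≡ rangeFrom 1 n
oneTo-range n = trans (map-applyUpTo suc (λ i → i) n) (applyUpTo-range suc 1 n (λ i → refl))
  where
    map-applyUpTo : ∀ (g f : ℕ → ℕ) k → map g (applyUpTo f k) ≡ applyUpTo (λ i → g (f i)) k
    map-applyUpTo g f zero = refl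
    map-applyUpTo g f (suc k) = cong (g (f 0) ∷_) (map-applyUpTo g (λ i → f (suc i)) k)
    applyUpTo-range : ∀ (f : ℕ → ℕ) a k → (∀ i → f i ≡ a + i) → applyUpTo f k ≡ rangeFrom a k
    applyUpTo-range f a zero h = refl
    applyUpTo-range f a (suc k) h =
      cong₂ _∷_ (trans (h 0) (+-identityʳ a))
        (applyUpTo-range (λ i → f (suc i)) (suc a) k (λ i → trans (h (suc i)) (+-suc a i)))

range-∈⁻ : ∀ {a k x} → x ∈ rangeFrom a k → (a ≤ x) × (x < a + k)
range-∈⁻ {a} {suc k} (here refl) = ≤-refl , subst (a <_) (sym (+-suc a k)) (s≤s (m≤m+n a k))
range-∈⁻ {a} {suc k} {x} (there m) with range-∈⁻ {suc a} {k} m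
... | a<x , x<end = <⇒≤ a<x , subst (x <_) (sym (+-suc a k)) x<end

range-∈⁺ : ∀ {a k x} → a ≤ x → x < a + k → x ∈ rangeFrom a k
range-∈⁺ {a} {zero} {x} a≤x x<end = ⊥-elim (<⇒≱ (subst (x <_) (+-identityʳ a) x<end) a≤x)
range-∈⁺ {a} {suc k} {x} a≤x x<end with m≤n⇒m<n∨m≡n a≤x
... | inj₂ refl = here refl
... | inj₁ a<x = there (range-∈⁺ a<x (subst (x <_) (+-suc a k) x<end))

ND-range : ∀ a k → ND (rangeFrom a k)
ND-range a zero = tt
ND-range a (suc k) = (λ m → <⇒≱ (proj₁ (range-∈⁻ m)) ≤-refl) , ND-range (suc a) k

length-range : ∀ a k → length (rangeFrom a k) ≡ k
length-range a zero = refl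
length-range a (suc k) = cong suc (length-range (suc a) k)

pred-range : ∀ a k → map (_∸ 1) (rangeFrom (suc a) k) ≡ rangeFrom a k
pred-range a zero = refl
pred-range a (suc k) = cong (a ∷_) (pred-range (suc a) k)

indicator : Bool → ℕ
indicator b = if b then 1 else 0

countB-++ : ∀ {A : Set} (p : A → Bool) xs ys → countB p (xs ++ ys) ≡ countB p xs + countB p ys
countB-++ p [] ys = refl
countB-++ p (x ∷ xs) ys =
  trans (cong (indicator (p x) +_) (countB-++ p xs ys)) (sym (+-assoc (indicator (p x)) _ _))

countB-↭ : ∀ (p : ℕ → Bool) {xs ys} → xs ↭ ys → countB p xs ≡ countB p ys
countB-↭ p ↭-refl′ = refl
countB-↭ p (prep x q) = cong (indicator (p x) +_) (countB-↭ p q)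
countB-↭ p {x ∷ y ∷ xs} {_ ∷ _ ∷ ys} (swap x y q) = begin
  X + (Y + countB p xs)  ≡⟨ sym (+-assoc X Y _) ⟩
  X + Y + countB p xs    ≡⟨ cong (_+ countB p xs) (+-comm X Y) ⟩
  Y + X + countB p xs    ≡⟨ +-assoc Y X _ ⟩
  Y + (X + countB p xs)  ≡⟨ cong (λ z → Y + (X + z)) (countB-↭ p q) ⟩
  Y + (X + countB p ys)  ∎
  where
    open ≡-Reasoning
    X Y : ℕ
    X = indicator (p x)
    Y = indicator (p y)
countB-↭ p (↭-trans′ q r) = trans (countB-↭ p q) (countB-↭ p r)

countB-cong : ∀ {A : Set} (p q : A → Bool) xs → (∀ x → x ∈ xs → p x ≡ q x) → countB p xs ≡ countB q xs
countB-cong p q [] h = refl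
countB-cong p q (x ∷ xs) h =
  cong₂ (λ b r → indicator b + r) (h x (here refl)) (countB-cong p q xs (λ y m → h y (there m)))

countB-true : ∀ {A : Set} (p : A → Bool) xs → (∀ x → x ∈ xs → p x ≡ true) → countB p xs ≡ length xs
countB-true p [] h = refl
countB-true p (x ∷ xs) h rewrite h x (here refl) = cong suc (countB-true p xs (λ y m → h y (there m)))

countB-false : ∀ {A : Set} (p : A → Bool) xs → (∀ x → x ∈ xs → p x ≡ false) → countB p xs ≡ 0
countB-false p [] h = refl
countB-false p (x ∷ xs) h rewrite h x (here refl) = countB-false p xs (λ y m → h y (there m))

countB-unique : ∀ (p : ℕ → Bool) c m → ND c → m ∈ c → (∀ x → x ∈ c → p x ≡ true → x ≡ m) →
                p m ≡ true → countB p c ≡ 1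
countB-unique p (y ∷ ys) m (y∉ , nd) (here refl) only pm rewrite pm =
  cong suc (countB-false p ys (λ x xm → ≢true⇒≡false (λ px → y∉ (subst (_∈ ys) (only x (there xm) px) xm))))
countB-unique p (y ∷ ys) m (y∉ , nd) (there mm) only pm with p y in e
... | true = ⊥-elim (y∉ (subst (_∈ ys) (sym (only y (here refl) e)) mm))
... | false = countB-unique p ys m nd mm (λ x xm px → only x (there xm) px) pm

indicator-mono : ∀ {a b} → (a ≡ true → b ≡ true) → indicator a ≤ indicator b
indicator-mono {false} ab = z≤n
indicator-mono {true} ab rewrite ab refl = ≤-refl

countB-mono : ∀ (p q : ℕ → Bool) s → (∀ z → z ∈ s → p z ≡ true → q z ≡ true) → countB p s ≤ countB q s
countB-mono p q [] h = z≤n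
countB-mono p q (z ∷ s) h =
  +-mono-≤ (indicator-mono (h z (here refl))) (countB-mono p q s (λ z' m → h z' (there m)))

countB-strict : ∀ (p q : ℕ → Bool) s → (∀ z → z ∈ s → p z ≡ true → q z ≡ true) →
  ∀ w → w ∈ s → p w ≡ false → q w ≡ true → countB p s < countB q s
countB-strict p q (z ∷ s) h w (here refl) pw qw rewrite pw | qw =
  s≤s (countB-mono p q s (λ z' m → h z' (there m)))
countB-strict p q (z ∷ s) h w (there wm) pw qw =
  +-mono-≤-< (indicator-mono (h z (here refl))) (countB-strict p q s (λ z' m → h z' (there m)) w wm pw qw)

-- Closed walks.  Walk σ l says σ maps each entry of l to the next one; a
-- cycle (h ∷ t) of σ is witnessed by  Walk σ (h ∷ t ++ [ h ]).

Walk : (ℕ → ℕ) → List ℕ → Set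
Walk σ [] = ⊤
Walk σ (a ∷ []) = ⊤
Walk σ (a ∷ b ∷ r) = (σ a ≡ b) × Walk σ (b ∷ r)

walk-split : ∀ σ l {y ys} → Walk σ (l ++ y ∷ ys) → Walk σ (l ++ [ y ]) × Walk σ (y ∷ ys)
walk-split σ [] w = tt , w
walk-split σ (a ∷ []) (e , w) = (e , tt) , w
walk-split σ (a ∷ b ∷ l) (e , w) with walk-split σ (b ∷ l) w
... | w₁ , w₂ = (e , w₁) , w₂

walk-join : ∀ σ l {y ys} → Walk σ (l ++ [ y ]) → Walk σ (y ∷ ys) → Walk σ (l ++ y ∷ ys)
walk-join σ [] w₁ w₂ = w₂
walk-join σ (a ∷ []) (e , _) w₂ = e , w₂
walk-join σ (a ∷ b ∷ l) (e , w₁) w₂ = e , walk-join σ (b ∷ l) w₁ w₂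

walk-cong : ∀ σ τ l e → Walk σ (l ++ [ e ]) → (∀ y → y ∈ l → σ y ≡ τ y) → Walk τ (l ++ [ e ])
walk-cong σ τ [] e w h = tt
walk-cong σ τ (a ∷ []) e (x , _) h = trans (sym (h a (here refl))) x , tt
walk-cong σ τ (a ∷ b ∷ l) e (x , w) h =
  trans (sym (h a (here refl))) x , walk-cong σ τ (b ∷ l) e w (λ y m → h y (there m))

iter-σ : ∀ σ k a → iter σ k (σ a) ≡ iter σ (suc k) a
iter-σ σ zero a = refl
iter-σ σ (suc k) a = cong σ (iter-σ σ k a)

walk-iter : ∀ σ a u b v → Walk σ (a ∷ u ++ b ∷ v) → iter σ (suc (length u)) a ≡ b
walk-iter σ a [] b v (e , _) = e
walk-iter σ a (c ∷ u) b v (e , w) =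
  trans (sym (iter-σ σ (suc (length u)) a)) (trans (cong (iter σ (suc (length u))) e) (walk-iter σ c u b v w))

walk-closed : ∀ σ l e → Walk σ (l ++ [ e ]) → ∀ {y} → y ∈ l → σ y ∈ l ++ [ e ]
walk-closed σ (a ∷ []) e (x , _) (here refl) = there (here x)
walk-closed σ (a ∷ b ∷ l) e (x , w) (here refl) = there (here x)
walk-closed σ (a ∷ b ∷ l) e (x , w) (there m) = there (walk-closed σ (b ∷ l) e w m)

split-at-index : ∀ (r : List ℕ) j → j < length r → ∃₂ λ u b → ∃ λ v → (r ≡ u ++ b ∷ v) × (length u ≡ j)
split-at-index (b ∷ r) zero _ = [] , b , r , refl , refl
split-at-index (c ∷ r) (suc j) (s≤s p) with split-at-index r j p
... | u , b , v , e , l = c ∷ u , b , v , cong (c ∷_) e , cong suc l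

walk-rotate : ∀ σ h t {x} → x ∈ h ∷ t → Walk σ (h ∷ t ++ [ h ]) →
  ∃ λ r → (Walk σ (x ∷ r ++ [ x ])) × ((x ∷ r) ↭ (h ∷ t))
walk-rotate σ h t (here refl) w = t , w , ↭-refl
walk-rotate σ h t {x} (there m) w with ∈-∃++ m
... | p , q , refl = q ++ h ∷ p , rotated , ↭-sym (++-comm (h ∷ p) (x ∷ q))
  where
    pieces : Walk σ ((h ∷ p) ++ [ x ]) × Walk σ (x ∷ q ++ [ h ])
    pieces = walk-split σ (h ∷ p) (subst (Walk σ) (cong (h ∷_) (++-assoc p (x ∷ q) [ h ])) w)
    rotated : Walk σ (x ∷ (q ++ h ∷ p) ++ [ x ])
    rotated = subst (Walk σ) (cong (x ∷_) (sym (++-assoc q (h ∷ p) [ x ])))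
                (walk-join σ (x ∷ q) (proj₂ pieces) (proj₁ pieces))

module Orbit (σ : ℕ → ℕ) (x : ℕ) (r : List ℕ) (w : Walk σ (x ∷ r ++ [ x ])) (nd : ND (x ∷ r)) where

  L : ℕ
  L = suc (length r)

  returns : iter σ L x ≡ x
  returns = walk-iter σ x r x [] w

  no-early-return : ∀ j → 1 ≤ j → j < L → iter σ j x ≢ x
  no-early-return (suc j) _ (s≤s j<) e with split-at-index r j j<
  ... | u , b , v , refl , refl = proj₁ nd (subst (_∈ (u ++ b ∷ v)) (trans (sym reaches-b) e) (∈-++⁺ʳ u (here refl)))
    where
      reaches-b : iter σ (suc (length u)) x ≡ b
      reaches-b = walk-iter σ x u b (v ++ [ x ]) (subst (Walk σ) (cong (x ∷_) (++-assoc u (b ∷ v) [ x ])) w)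

  closed : ∀ {y} → y ∈ x ∷ r → σ y ∈ x ∷ r
  closed m with ∈-++⁻ (x ∷ r) (walk-closed σ (x ∷ r) x w m)
  ... | inj₁ m′ = m′
  ... | inj₂ (here e) = subst (_∈ x ∷ r) (sym e) (here refl)

  iter-∈ : ∀ j → iter σ j x ∈ x ∷ r
  iter-∈ zero = here refl
  iter-∈ (suc j) = closed (iter-∈ j)

  ∈⇒iter : ∀ {y} → y ∈ x ∷ r → ∃ λ j → (1 ≤ j) × (j ≤ L) × (iter σ j x ≡ y)
  ∈⇒iter (here refl) = L , s≤s z≤n , ≤-refl , returns
  ∈⇒iter (there m) with ∈-∃++ m
  ... | u , v , refl = suc (length u) , s≤s z≤n ,
        s≤s (subst (length u ≤_) (sym (length-++ u)) (m≤m+n (length u) _)) ,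
        walk-iter σ x u _ (v ++ [ x ]) (subst (Walk σ) (cong (x ∷_) (++-assoc u (_ ∷ v) [ x ])) w)

cycleLenSearch-first : ∀ σ x a k L → a ≤ L → L < a + k → (∀ j → a ≤ j → j < L → iter σ j x ≢ x) →
  iter σ L x ≡ x → cycleLenSearch σ x (rangeFrom a k) ≡ L
cycleLenSearch-first σ x a zero L a≤L L< early ret = ⊥-elim (<⇒≱ (subst (L <_) (+-identityʳ a) L<) a≤L)
cycleLenSearch-first σ x a (suc k) L a≤L L< early ret with iter σ a x ≡ᵇ x in e | m≤n⇒m<n∨m≡n a≤L
... | true  | inj₂ a≡L = a≡L
... | true  | inj₁ a<L = ⊥-elim (early a ≤-refl a<L (≡ᵇ-sound _ _ e))
... | false | inj₂ refl = ⊥-elim (true≢false (trans (sym (≡ᵇ-complete ret)) e))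
... | false | inj₁ a<L =
  cycleLenSearch-first σ x (suc a) k L a<L (subst (L <_) (+-suc a k) L<) (λ j a<j → early j (<⇒≤ a<j)) ret

allB-sound : ∀ {A : Set} (p : A → Bool) l → allB p l ≡ true → ∀ y → y ∈ l → p y ≡ true
allB-sound p (z ∷ l) e y (here refl) with p z
... | true = refl
... | false = e
allB-sound p (z ∷ l) e y (there m) with p z
... | true = allB-sound p l e y m
... | false = ⊥-elim (true≢false (sym e))

allB-complete : ∀ {A : Set} (p : A → Bool) l → (∀ y → y ∈ l → p y ≡ true) → allB p l ≡ true
allB-complete p [] h = refl
allB-complete p (z ∷ l) h rewrite h z (here refl) = allB-complete p l (λ y m → h y (there m))

IsMinOf : List ℕ → ℕ → Bool
IsMinOf c x = allB (x ≤ᵇ_) c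

cycle-statistics : ∀ σ n h t → ND (h ∷ t) → Walk σ (h ∷ t ++ [ h ]) → length (h ∷ t) ≤ n →
  ∀ x → x ∈ h ∷ t → (cycleLen σ n x ≡ length (h ∷ t)) × (isCycleMin σ n x ≡ IsMinOf (h ∷ t) x)
cycle-statistics σ n h t nd w len x m with walk-rotate σ h t m w
... | r , w′ , x∷r↭c = length-eq , min-eq
  where
    open Orbit σ x r w′ (ND-↭ (↭-sym x∷r↭c) nd)
    L≤n : L ≤ n
    L≤n = subst (_≤ n) (sym (↭-length x∷r↭c)) len
    length-eq : cycleLen σ n x ≡ length (h ∷ t)
    length-eq = trans (cong (cycleLenSearch σ x) (oneTo-range n))
      (trans (cycleLenSearch-first σ x 1 n L (s≤s z≤n) (s≤s L≤n) no-early-return returns) (↭-length x∷r↭c))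
    orbit-bound⇒min : allB (λ j → x ≤ᵇ iter σ j x) (rangeFrom 1 n) ≡ true → IsMinOf (h ∷ t) x ≡ true
    orbit-bound⇒min e = allB-complete _ (h ∷ t) λ y ym →
      let (j , 1≤j , j≤L , xj≡y) = ∈⇒iter (∈-resp-↭ (↭-sym x∷r↭c) ym)
      in subst (λ z → (x ≤ᵇ z) ≡ true) xj≡y
           (allB-sound _ (rangeFrom 1 n) e j (range-∈⁺ 1≤j (s≤s (≤-trans j≤L L≤n))))
    min⇒orbit-bound : IsMinOf (h ∷ t) x ≡ true → allB (λ j → x ≤ᵇ iter σ j x) (rangeFrom 1 n) ≡ true
    min⇒orbit-bound e = allB-complete _ (rangeFrom 1 n) λ j _ →
      allB-sound _ (h ∷ t) e (iter σ j x) (∈-resp-↭ x∷r↭c (iter-∈ j))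
    min-eq : isCycleMin σ n x ≡ IsMinOf (h ∷ t) x
    min-eq = trans (cong (allB (λ j → x ≤ᵇ iter σ j x)) (oneTo-range n)) (bool-ext orbit-bound⇒min min⇒orbit-bound)

exists-min : ∀ h t → ∃ λ m → (m ∈ h ∷ t) × (∀ y → y ∈ h ∷ t → m ≤ y)
exists-min h [] = h , here refl , λ { y (here refl) → ≤-refl }
exists-min h (z ∷ t) with exists-min z t
... | m , mm , mle with ≤-total h m
...   | inj₁ h≤m = h , here refl , λ { y (here refl) → ≤-refl ; y (there i) → ≤-trans h≤m (mle y i) }
...   | inj₂ m≤h = m , there mm , λ { y (here refl) → m≤h ; y (there i) → mle y i }

count-minima : ∀ h t → ND (h ∷ t) → countB (IsMinOf (h ∷ t)) (h ∷ t) ≡ 1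
count-minima h t nd with exists-min h t
... | m , mm , mle = countB-unique _ (h ∷ t) m nd mm
  (λ x xm px → ≤-antisym (≤ᵇ-sound x m (allB-sound _ (h ∷ t) px m mm)) (mle x xm))
  (allB-complete _ (h ∷ t) λ y ym → ≤ᵇ-complete (mle y ym))

nextIn-∉ : ∀ f x l d → x ∉ l → nextIn f x l d ≡ d
nextIn-∉ f x [] d h = refl
nextIn-∉ f x (y ∷ []) d h rewrite ≡ᵇ-false y x (λ e → h (here (sym e))) = refl
nextIn-∉ f x (y ∷ z ∷ ys) d h =
  trans (cong (λ b → if b then z else nextIn f x (z ∷ ys) d) (≡ᵇ-false y x (λ e → h (here (sym e)))))
        (nextIn-∉ f x (z ∷ ys) d (λ m → h (there m)))

nextIn-range : ∀ f x l d → (nextIn f x l d ≡ f) ⊎ ((nextIn f x l d ≡ d) ⊎ (nextIn f x l d ∈ l))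
nextIn-range f x [] d = inj₂ (inj₁ refl)
nextIn-range f x (y ∷ []) d with y ≡ᵇ x
... | true = inj₁ refl
... | false = inj₂ (inj₁ refl)
nextIn-range f x (y ∷ z ∷ ys) d with y ≡ᵇ x | nextIn-range f x (z ∷ ys) d
... | true  | _ = inj₂ (inj₂ (there (here refl)))
... | false | inj₁ e = inj₁ e
... | false | inj₂ (inj₁ e) = inj₂ (inj₁ e)
... | false | inj₂ (inj₂ m) = inj₂ (inj₂ (there m))

cycle-walk : ∀ first y₀ rest → ND (y₀ ∷ rest) →
  Walk (λ y → nextIn first y (y₀ ∷ rest) y) (y₀ ∷ rest ++ [ first ])
cycle-walk first y₀ [] nd rewrite ≡ᵇ-refl y₀ = refl , tt
cycle-walk first y₀ (z ∷ ys) (y₀∉ , nd) = step ,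
  walk-cong (λ y → nextIn first y (z ∷ ys) y) (λ y → nextIn first y (y₀ ∷ z ∷ ys) y) (z ∷ ys) first
    (cycle-walk first z ys nd) (λ y m → sym (skip-head y m))
  where
    step : nextIn first y₀ (y₀ ∷ z ∷ ys) y₀ ≡ z
    step rewrite ≡ᵇ-refl y₀ = refl
    skip-head : ∀ y → y ∈ z ∷ ys → nextIn first y (y₀ ∷ z ∷ ys) y ≡ nextIn first y (z ∷ ys) y
    skip-head y m rewrite ≡ᵇ-false y₀ y (λ e → y₀∉ (subst (_∈ z ∷ ys) (sym e) m)) = refl

applyCycle-∉ : ∀ c x → x ∉ c → applyCycle c x ≡ x
applyCycle-∉ [] x h = refl
applyCycle-∉ (a ∷ r) x h = nextIn-∉ a x (a ∷ r) x h

applyCycle-∈ : ∀ c x → x ∈ c → applyCycle c x ∈ c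
applyCycle-∈ (a ∷ r) x m with nextIn-range a x (a ∷ r) x
... | inj₁ e = subst (_∈ a ∷ r) (sym e) (here refl)
... | inj₂ (inj₁ e) = subst (_∈ a ∷ r) (sym e) m
... | inj₂ (inj₂ m′) = m′

applyCycles-∉ : ∀ cs x → x ∉ concat cs → applyCycles cs x ≡ x
applyCycles-∉ [] x h = refl
applyCycles-∉ (c ∷ cs) x h =
  trans (cong (applyCycle c) (applyCycles-∉ cs x (λ m → h (∈-++⁺ʳ c m)))) (applyCycle-∉ c x (λ m → h (∈-++⁺ˡ m)))

applyCycles-++ : ∀ as bs x → applyCycles (as ++ bs) x ≡ applyCycles as (applyCycles bs x)
applyCycles-++ [] bs x = refl
applyCycles-++ (a ∷ as) bs x = cong (applyCycle a) (applyCycles-++ as bs x)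

length-middle : ∀ (xs ys zs : List ℕ) → length ys ≤ length (xs ++ ys ++ zs)
length-middle xs ys zs = subst (length ys ≤_) (sym (trans (length-++ xs) (cong (length xs +_) (length-++ ys))))
  (≤-trans (m≤m+n (length ys) (length zs)) (m≤n+m _ (length xs)))

module CycleProduct (n : ℕ) (cs : List (List ℕ)) (cover : concat cs ↭ oneTo n)
                    (nonempty : ∀ c → c ∈ cs → 0 < length c) where

  σ : ℕ → ℕ
  σ = applyCycles cs

  nd-cs : ND (concat cs)
  nd-cs = ND-↭ (↭-sym cover) (subst ND (sym (oneTo-range n)) (ND-range 1 n))

  length-cs : length (concat cs) ≡ n
  length-cs = trans (↭-length cover) (trans (cong length (oneTo-range n)) (length-range 1 n))

  member-cycle : ∀ h t → (h ∷ t) ∈ cs → ∀ x → x ∈ h ∷ t →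
    (cycleLen σ n x ≡ length (h ∷ t)) × (isCycleMin σ n x ≡ IsMinOf (h ∷ t) x) × ND (h ∷ t)
  member-cycle h t cm x xm with ∈-∃++ cm
  ... | as , bs , cs≡ =
    let (len , min) = cycle-statistics σ n h t nd-c (walk-cong (applyCycle c) σ c h (cycle-walk h h t nd-c) σ-on-c)
                                       length-c x xm
    in len , min , nd-c
    where
      c : List ℕ
      c = h ∷ t
      split : concat cs ≡ concat as ++ c ++ concat bs
      split = trans (cong concat cs≡) (sym (concat-++ as (c ∷ bs)))
      nd-split : ND (concat as ++ c ++ concat bs)
      nd-split = subst ND split nd-cs
      nd-c : ND c
      nd-c = ND-++ˡ c (ND-++ʳ (concat as) nd-split)
      length-c : length c ≤ n
      length-c = subst (length c ≤_) (trans (cong length (sym split)) length-cs)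
                       (length-middle (concat as) c (concat bs))
      -- the other cycles fix every point of c and the points c maps to
      σ-on-c : ∀ y → y ∈ c → applyCycle c y ≡ σ y
      σ-on-c y ym = sym (begin
          applyCycles cs y                                   ≡⟨ cong (λ z → applyCycles z y) cs≡ ⟩
          applyCycles (as ++ c ∷ bs) y                       ≡⟨ applyCycles-++ as (c ∷ bs) y ⟩
          applyCycles as (applyCycle c (applyCycles bs y))
            ≡⟨ cong (λ z → applyCycles as (applyCycle c z))
                    (applyCycles-∉ bs y (ND-++-disjoint c (ND-++ʳ (concat as) nd-split) ym)) ⟩
          applyCycles as (applyCycle c y)
            ≡⟨ applyCycles-∉ as _ (λ m → ND-++-disjoint (concat as) nd-split m (∈-++⁺ˡ (applyCycle-∈ c y ym))) ⟩
          applyCycle c y                                     ∎)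
        where open ≡-Reasoning

  module Statistic (F : Bool → ℕ → Bool) (F-off-min : ∀ l → F false l ≡ false) where

    P : ℕ → Bool
    P x = F (isCycleMin σ n x) (cycleLen σ n x)

    per-cycle : ∀ c → c ∈ cs → countB P c ≡ indicator (F true (length c))
    per-cycle [] cm = ⊥-elim (<-irrefl refl (nonempty [] cm))
    per-cycle (h ∷ t) cm = trans (countB-cong P (λ x → F (IsMinOf c x) (length c)) c on-c) by-minimum
      where
        c : List ℕ
        c = h ∷ t
        nd-c : ND c
        nd-c = proj₂ (proj₂ (member-cycle h t cm h (here refl)))
        on-c : ∀ x → x ∈ c → P x ≡ F (IsMinOf c x) (length c)
        on-c x xm = let (len , min , _) = member-cycle h t cm x xm in cong₂ F min len
        by-minimum : countB (λ x → F (IsMinOf c x) (length c)) c ≡ indicator (F true (length c))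
        by-minimum with F true (length c) in eT
        ... | true = trans (countB-cong _ _ c (λ x _ → F-at-min x)) (count-minima h t nd-c)
          where
            F-at-min : ∀ x → F (IsMinOf c x) (length c) ≡ IsMinOf c x
            F-at-min x with IsMinOf c x
            ... | true = eT
            ... | false = F-off-min _
        ... | false = countB-false _ c F-vanishes
          where
            F-vanishes : ∀ x → x ∈ c → F (IsMinOf c x) (length c) ≡ false
            F-vanishes x _ with IsMinOf c x
            ... | true = eT
            ... | false = F-off-min _

    sum-cycles : ∀ bs → (∀ c → c ∈ bs → c ∈ cs) → countB P (concat bs) ≡ countB (λ c → F true (length c)) bs
    sum-cycles [] _ = refl
    sum-cycles (c ∷ bs) sub = trans (countB-++ P c (concat bs))
      (cong₂ _+_ (per-cycle c (sub c (here refl))) (sum-cycles bs (λ c′ m → sub c′ (there m))))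

    counting : countB P (oneTo n) ≡ countB (λ c → F true (length c)) cs
    counting = trans (sym (countB-↭ P cover)) (sum-cycles cs (λ c m → m))

  cyc-count : cyc n σ ≡ length cs
  cyc-count = trans (Statistic.counting (λ b l → b) (λ l → refl)) (countB-true _ cs (λ _ _ → refl))

  cycE-count : cycE n σ ≡ countB (λ c → even? (length c)) cs
  cycE-count = Statistic.counting (λ b l → b ∧ even? l) (λ l → refl)

  cycO-count : cycO n σ ≡ countB (λ c → not (even? (length c))) cs
  cycO-count = Statistic.counting (λ b l → b ∧ not (even? l)) (λ l → refl)

Anti : (ℕ → ℕ) → List ℕ → Set
Anti h w = ∀ x y → x ∈ w → y ∈ w → x < y → h y < h x

Anti-inj : ∀ h w → Anti h w → ∀ x y → x ∈ w → y ∈ w → h x ≡ h y → x ≡ y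
Anti-inj h w anti x y xm ym e with <-cmp x y
... | tri< x<y _ _ = ⊥-elim (<-irrefl (sym e) (anti x y xm ym x<y))
... | tri≈ _ x≡y _ = x≡y
... | tri> _ _ y<x = ⊥-elim (<-irrefl e (anti y x ym xm y<x))

Sub : List ℕ → List ℕ → Set
Sub w W = ∀ y → y ∈ w → y ∈ W

Anti-sub : ∀ h W w → Anti h W → Sub w W → Anti h w
Anti-sub h W w anti sub x y xm ym = anti x y (sub x xm) (sub y ym)

rankBelow : List ℕ → ℕ → ℕ
rankBelow s x = countB (λ z → z <ᵇ x) s

rankAbove : List ℕ → ℕ → ℕ
rankAbove s y = countB (λ z → y <ᵇ z) s

rankBelow-strict : ∀ s x y → x ∈ s → x < y → rankBelow s x < rankBelow s y
rankBelow-strict s x y xm x<y = countB-strict _ _ s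
  (λ z _ e → <ᵇ-complete (<-trans (<ᵇ-sound z x e) x<y)) x xm (<ᵇ-irrefl x) (<ᵇ-complete x<y)

rankAbove-strict : ∀ s x y → y ∈ s → x < y → rankAbove s y < rankAbove s x
rankAbove-strict s x y ym x<y = countB-strict _ _ s
  (λ z _ e → <ᵇ-complete (<-trans x<y (<ᵇ-sound y z e))) y ym (<ᵇ-irrefl y) (<ᵇ-complete x<y)

countB-<-length : ∀ (p : ℕ → Bool) s x → x ∈ s → p x ≡ false → countB p s < length s
countB-<-length p s x xm px = subst (countB p s <_) (countB-true (λ _ → true) s (λ _ _ → refl))
  (countB-strict p (λ _ → true) s (λ _ _ _ → refl) x xm px refl)

pickGreater-spec : ∀ w k ys → (∃ λ y → (y ∈ ys) × (rankAbove w y ≡ k)) →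
  (pickGreater w k ys ∈ ys) × (rankAbove w (pickGreater w k ys) ≡ k)
pickGreater-spec w k (y ∷ ys) found with (rankAbove w y ≡ᵇ k) in e | found
... | true | _ = here refl , ≡ᵇ-sound _ _ e
... | false | (_ , here refl , e′) = ⊥-elim (true≢false (trans (sym (≡ᵇ-complete e′)) e))
... | false | (y′ , there m , e′) = let (m″ , e″) = pickGreater-spec w k ys (y′ , m , e′) in there m″ , e″

module Switch (s : List ℕ) (nd : ND s) where

  switchMap : ℕ → ℕ
  switchMap x = pickGreater s (rankBelow s x) s

  rankAbove-inj : ∀ x y → x ∈ s → y ∈ s → rankAbove s x ≡ rankAbove s y → x ≡ y
  rankAbove-inj x y xm ym e with <-cmp x y
  ... | tri< x<y _ _ = ⊥-elim (<-irrefl (sym e) (rankAbove-strict s x y ym x<y))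
  ... | tri≈ _ x≡y _ = x≡y
  ... | tri> _ _ y<x = ⊥-elim (<-irrefl e (rankAbove-strict s y x xm y<x))

  ranks-cover : map (rankAbove s) s ↭ rangeFrom 0 (length s)
  ranks-cover = ND-⊆-length⇒↭ (map (rankAbove s) s) (rangeFrom 0 (length s))
    (ND-map (rankAbove s) s nd rankAbove-inj)
    (λ k km → let (y , ym , e) = ∈-map⁻ (rankAbove s) km in
       range-∈⁺ z≤n (subst (_< length s) (sym e) (countB-<-length _ s y ym (<ᵇ-irrefl y))))
    (≤-reflexive (trans (length-range 0 (length s)) (sym (length-map (rankAbove s) s))))

  switchMap-spec : ∀ x → x ∈ s → (switchMap x ∈ s) × (rankAbove s (switchMap x) ≡ rankBelow s x)
  switchMap-spec x xm with ∈-map⁻ (rankAbove s) (∈-resp-↭ (↭-sym ranks-cover)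
                             (range-∈⁺ z≤n (countB-<-length _ s x xm (<ᵇ-irrefl x))))
  ... | y , ym , e = pickGreater-spec s (rankBelow s x) s (y , ym , sym e)

  switchMap-anti : Anti switchMap s
  switchMap-anti x y xm ym x<y with switchMap-spec x xm | switchMap-spec y ym | <-cmp (switchMap y) (switchMap x)
  ... | _ | _ | tri< fy<fx _ _ = fy<fx
  ... | _ , ex | _ , ey | tri≈ _ fy≡fx _ =
    ⊥-elim (<-irrefl (trans (sym ex) (trans (cong (rankAbove s) (sym fy≡fx)) ey)) (rankBelow-strict s x y xm x<y))
  ... | _ , ex | fym , ey | tri> _ _ fx<fy =
    ⊥-elim (<-asym (rankBelow-strict s x y xm x<y)
                   (subst₂ _<_ ey ex (rankAbove-strict s (switchMap x) (switchMap y) fym fx<fy)))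

  switch-↭ : switch s ↭ s
  switch-↭ = ND-⊆-length⇒↭ (map switchMap s) s (ND-map switchMap s nd (Anti-inj switchMap s switchMap-anti))
    (λ z zm → let (x , xm , e) = ∈-map⁻ switchMap zm in subst (_∈ s) (sym e) (proj₁ (switchMap-spec x xm)))
    (≤-reflexive (sym (length-map switchMap s)))

  nd-switch : ND (switch s)
  nd-switch = ND-↭ (↭-sym switch-↭) nd

  length-switch : length (switch s) ≡ length s
  length-switch = length-map switchMap s

splitAtVal-≡ : ∀ v w → v ∈ w → w ≡ proj₁ (splitAtVal v w) ++ v ∷ proj₂ (splitAtVal v w)
splitAtVal-≡ v (x ∷ xs) m with x ≡ᵇ v in e | m
... | true | _ = cong (_∷ xs) (≡ᵇ-sound x v e)
... | false | here refl = ⊥-elim (true≢false (trans (sym (≡ᵇ-refl x)) e))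
... | false | there m′ = cong (x ∷_) (splitAtVal-≡ v xs m′)

splitAtVal-prefix-∉ : ∀ v w → v ∉ proj₁ (splitAtVal v w)
splitAtVal-prefix-∉ v (x ∷ xs) m with x ≡ᵇ v in e | m
... | false | here refl = true≢false (trans (sym (≡ᵇ-refl x)) e)
... | false | there m′ = splitAtVal-prefix-∉ v xs m′

splitAtVal-suffix-⊆ : ∀ v w → Sub (proj₂ (splitAtVal v w)) w
splitAtVal-suffix-⊆ v (x ∷ xs) y m with x ≡ᵇ v
... | true = there m
... | false = there (splitAtVal-suffix-⊆ v xs y m)

splitAtVal-map : ∀ h v w → (∀ x y → x ∈ w → y ∈ w → h x ≡ h y → x ≡ y) → v ∈ w →
  splitAtVal (h v) (map h w) ≡ (map h (proj₁ (splitAtVal v w)) , map h (proj₂ (splitAtVal v w)))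
splitAtVal-map h v w inj vm = go w (λ y m → m)
  where
    ≡ᵇ-under-h : ∀ x → x ∈ w → (h x ≡ᵇ h v) ≡ (x ≡ᵇ v)
    ≡ᵇ-under-h x xm with x ≡ᵇ v in e
    ... | true rewrite ≡ᵇ-sound x v e = ≡ᵇ-refl (h v)
    ... | false = ≡ᵇ-false (h x) (h v) (λ hx≡hv → true≢false (trans (sym (≡ᵇ-complete (inj x v xm vm hx≡hv))) e))
    go : ∀ u → Sub u w →
      splitAtVal (h v) (map h u) ≡ (map h (proj₁ (splitAtVal v u)) , map h (proj₂ (splitAtVal v u)))
    go [] sub = refl
    go (x ∷ xs) sub rewrite ≡ᵇ-under-h x (sub x (here refl)) with x ≡ᵇ v
    ... | true = refl
    ... | false rewrite go xs (λ y m → sub y (there m)) = refl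

minFrom-∈ : ∀ m xs → minFrom m xs ∈ m ∷ xs
minFrom-∈ m [] = here refl
minFrom-∈ m (x ∷ xs) with x <ᵇ m | minFrom-∈ (if x <ᵇ m then x else m) xs
... | true | i = there i
... | false | here e = here e
... | false | there i = there (there i)

maxFrom-∈ : ∀ m xs → maxFrom m xs ∈ m ∷ xs
maxFrom-∈ m [] = here refl
maxFrom-∈ m (x ∷ xs) with m <ᵇ x | maxFrom-∈ (if m <ᵇ x then x else m) xs
... | true | i = there i
... | false | here e = here e
... | false | there i = there (there i)

minFrom-≤ : ∀ m xs y → y ∈ m ∷ xs → minFrom m xs ≤ y
minFrom-≤ m [] y (here refl) = ≤-refl
minFrom-≤ m (x ∷ xs) y ym with x <ᵇ m in e
minFrom-≤ m (x ∷ xs) y (here refl) | true = <⇒≤ (≤-<-trans (minFrom-≤ x xs x (here refl)) (<ᵇ-sound x m e))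
minFrom-≤ m (x ∷ xs) y (there ym) | true = minFrom-≤ x xs y ym
minFrom-≤ m (x ∷ xs) y (here refl) | false = minFrom-≤ m xs y (here refl)
minFrom-≤ m (x ∷ xs) y (there (here refl)) | false = ≤-trans (minFrom-≤ m xs m (here refl)) (<ᵇ-false-sound x m e)
minFrom-≤ m (x ∷ xs) y (there (there ym)) | false = minFrom-≤ m xs y (there ym)

minFrom-unique : ∀ m xs v → v ∈ m ∷ xs → (∀ y → y ∈ m ∷ xs → v ≤ y) → minFrom m xs ≡ v
minFrom-unique m xs v vm v-min = ≤-antisym (minFrom-≤ m xs v vm) (v-min _ (minFrom-∈ m xs))

if-map : ∀ (h : ℕ → ℕ) (b : Bool) x y → (if b then h x else h y) ≡ h (if b then x else y)
if-map h true x y = refl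
if-map h false x y = refl

minFrom-anti : ∀ h W m xs → Anti h W → m ∈ W → Sub xs W → minFrom (h m) (map h xs) ≡ h (maxFrom m xs)
minFrom-anti h W m [] anti mm sub = refl
minFrom-anti h W m (x ∷ xs) anti mm sub =
  trans (cong (λ z → minFrom z (map h xs)) (trans compare (if-map h (m <ᵇ x) x m)))
    (minFrom-anti h W (if m <ᵇ x then x else m) xs anti (larger-∈ (m <ᵇ x)) (λ y i → sub y (there i)))
  where
    xm : x ∈ W
    xm = sub x (here refl)
    larger-∈ : ∀ b → (if b then x else m) ∈ W
    larger-∈ true = xm
    larger-∈ false = mm
    compare : (if h x <ᵇ h m then h x else h m) ≡ (if m <ᵇ x then h x else h m)
    compare with <-cmp m x
    ... | tri< m<x _ _ rewrite <ᵇ-complete (anti m x mm xm m<x) | <ᵇ-complete m<x = refl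
    ... | tri≈ _ refl _ rewrite <ᵇ-irrefl m | <ᵇ-irrefl (h m) = refl
    ... | tri> _ _ x<m rewrite <ᵇ-false-complete {h x} {h m} (<⇒≤ (anti x m xm mm x<m))
                             | <ᵇ-false-complete {m} {x} (<⇒≤ x<m) = refl

maxFrom-anti : ∀ h W m xs → Anti h W → m ∈ W → Sub xs W → maxFrom (h m) (map h xs) ≡ h (minFrom m xs)
maxFrom-anti h W m [] anti mm sub = refl
maxFrom-anti h W m (x ∷ xs) anti mm sub =
  trans (cong (λ z → maxFrom z (map h xs)) (trans compare (if-map h (x <ᵇ m) x m)))
    (maxFrom-anti h W (if x <ᵇ m then x else m) xs anti (smaller-∈ (x <ᵇ m)) (λ y i → sub y (there i)))
  where
    xm : x ∈ W
    xm = sub x (here refl)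
    smaller-∈ : ∀ b → (if b then x else m) ∈ W
    smaller-∈ true = xm
    smaller-∈ false = mm
    compare : (if h m <ᵇ h x then h x else h m) ≡ (if x <ᵇ m then h x else h m)
    compare with <-cmp m x
    ... | tri< m<x _ _ rewrite <ᵇ-false-complete {h m} {h x} (<⇒≤ (anti m x mm xm m<x))
                             | <ᵇ-false-complete {x} {m} (<⇒≤ m<x) = refl
    ... | tri≈ _ refl _ rewrite <ᵇ-irrefl m | <ᵇ-irrefl (h m) = refl
    ... | tri> _ _ x<m rewrite <ᵇ-complete (anti x m xm mm x<m) | <ᵇ-complete x<m = refl

-- The min-max subsequence.  stepMin/stepMax are the continuation of
-- stMin/stMax after the extremal entry has been cut off; an order-reversing
-- map turns the min-max subsequence into the max-min subsequence.

stepMin : ℕ → List ℕ → ℕ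
stepMin fuel [] = 1
stepMin fuel (r ∷ rs) = suc (stMax fuel (r ∷ rs))

stepMax : ℕ → List ℕ → ℕ
stepMax fuel [] = 1
stepMax fuel (r ∷ rs) = suc (stMin fuel (r ∷ rs))

stMin-step : ∀ fuel x xs → stMin (suc fuel) (x ∷ xs) ≡ stepMin fuel (proj₂ (splitAtVal (minFrom x xs) (x ∷ xs)))
stMin-step fuel x xs with proj₂ (splitAtVal (minFrom x xs) (x ∷ xs))
... | [] = refl
... | r ∷ rs = refl

stMax-step : ∀ fuel x xs → stMax (suc fuel) (x ∷ xs) ≡ stepMax fuel (proj₂ (splitAtVal (maxFrom x xs) (x ∷ xs)))
stMax-step fuel x xs with proj₂ (splitAtVal (maxFrom x xs) (x ∷ xs))
... | [] = refl
... | r ∷ rs = refl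

mutual
  stMin-anti : ∀ fuel h w → Anti h w → stMin fuel (map h w) ≡ stMax fuel w
  stMin-anti zero h w anti = refl
  stMin-anti (suc fuel) h [] anti = refl
  stMin-anti (suc fuel) h (x ∷ xs) anti = begin
    stMin (suc fuel) (h x ∷ map h xs)
      ≡⟨ stMin-step fuel (h x) (map h xs) ⟩
    stepMin fuel (proj₂ (splitAtVal (minFrom (h x) (map h xs)) (h x ∷ map h xs)))
      ≡⟨ cong (λ v → stepMin fuel (proj₂ (splitAtVal v (h x ∷ map h xs))))
              (minFrom-anti h (x ∷ xs) x xs anti (here refl) (λ y → there)) ⟩
    stepMin fuel (proj₂ (splitAtVal (h (maxFrom x xs)) (map h (x ∷ xs))))
      ≡⟨ cong (λ p → stepMin fuel (proj₂ p))
              (splitAtVal-map h (maxFrom x xs) (x ∷ xs) (Anti-inj h (x ∷ xs) anti) (maxFrom-∈ x xs)) ⟩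
    stepMin fuel (map h (proj₂ (splitAtVal (maxFrom x xs) (x ∷ xs))))
      ≡⟨ stepMin-anti fuel h _ (Anti-sub h (x ∷ xs) _ anti (splitAtVal-suffix-⊆ _ (x ∷ xs))) ⟩
    stepMax fuel (proj₂ (splitAtVal (maxFrom x xs) (x ∷ xs)))
      ≡⟨ sym (stMax-step fuel x xs) ⟩
    stMax (suc fuel) (x ∷ xs) ∎
    where open ≡-Reasoning

  stMax-anti : ∀ fuel h w → Anti h w → stMax fuel (map h w) ≡ stMin fuel w
  stMax-anti zero h w anti = refl
  stMax-anti (suc fuel) h [] anti = refl
  stMax-anti (suc fuel) h (x ∷ xs) anti = begin
    stMax (suc fuel) (h x ∷ map h xs)
      ≡⟨ stMax-step fuel (h x) (map h xs) ⟩
    stepMax fuel (proj₂ (splitAtVal (maxFrom (h x) (map h xs)) (h x ∷ map h xs)))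
      ≡⟨ cong (λ v → stepMax fuel (proj₂ (splitAtVal v (h x ∷ map h xs))))
              (maxFrom-anti h (x ∷ xs) x xs anti (here refl) (λ y → there)) ⟩
    stepMax fuel (proj₂ (splitAtVal (h (minFrom x xs)) (map h (x ∷ xs))))
      ≡⟨ cong (λ p → stepMax fuel (proj₂ p))
              (splitAtVal-map h (minFrom x xs) (x ∷ xs) (Anti-inj h (x ∷ xs) anti) (minFrom-∈ x xs)) ⟩
    stepMax fuel (map h (proj₂ (splitAtVal (minFrom x xs) (x ∷ xs))))
      ≡⟨ stepMax-anti fuel h _ (Anti-sub h (x ∷ xs) _ anti (splitAtVal-suffix-⊆ _ (x ∷ xs))) ⟩
    stepMin fuel (proj₂ (splitAtVal (minFrom x xs) (x ∷ xs)))
      ≡⟨ sym (stMin-step fuel x xs) ⟩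
    stMin (suc fuel) (x ∷ xs) ∎
    where open ≡-Reasoning

  stepMin-anti : ∀ fuel h s → Anti h s → stepMin fuel (map h s) ≡ stepMax fuel s
  stepMin-anti fuel h [] anti = refl
  stepMin-anti fuel h (r ∷ rs) anti = cong suc (stMax-anti fuel h (r ∷ rs) anti)

  stepMax-anti : ∀ fuel h s → Anti h s → stepMax fuel (map h s) ≡ stepMin fuel s
  stepMax-anti fuel h [] anti = refl
  stepMax-anti fuel h (r ∷ rs) anti = cong suc (stMin-anti fuel h (r ∷ rs) anti)

mutual
  down-anti : ∀ h W a w → Anti h W → Sub (a ∷ w) W → DownFrom a w → UpFrom (h a) (map h w)
  down-anti h W a [] anti sub _ = tt
  down-anti h W a (b ∷ w) anti sub (b<a , up) =
    anti b a (sub b (there (here refl))) (sub a (here refl)) b<a , up-anti h W b w anti (λ y i → sub y (there i)) up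

  up-anti : ∀ h W a w → Anti h W → Sub (a ∷ w) W → UpFrom a w → DownFrom (h a) (map h w)
  up-anti h W a [] anti sub _ = tt
  up-anti h W a (b ∷ w) anti sub (a<b , down) =
    anti a b (sub a (here refl)) (sub b (there (here refl))) a<b , down-anti h W b w anti (λ y i → sub y (there i)) down

anti-up-down : ∀ h m s → Anti h s → UpFrom m s → UpDown (map h s)
anti-up-down h m [] anti _ = tt
anti-up-down h m (s₁ ∷ s) anti (_ , down) = down-anti h (s₁ ∷ s) s₁ s anti (λ y i → i) down

mutual
  up-pred : ∀ a w → UpFrom (suc a) (map suc w) → UpFrom a w
  up-pred a [] _ = tt
  up-pred a (b ∷ w) (s≤s a<b , down) = a<b , down-pred b w down

  down-pred : ∀ a w → DownFrom (suc a) (map suc w) → DownFrom a w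
  down-pred a [] _ = tt
  down-pred a (b ∷ w) (s≤s b<a , up) = b<a , up-pred b w up

up-down-pred : ∀ w → UpDown (map suc w) → UpDown w
up-down-pred [] _ = tt
up-down-pred (x ∷ w) ud = up-pred x w ud

-- The minimum m of an alternating word sits at an odd position (1-based) of
-- an up-down word and at an even position of a down-up word, and the word
-- goes up right after it.
mutual
  up-split-at-min : ∀ m x xs → UpFrom x xs → m ∈ x ∷ xs → (∀ y → y ∈ x ∷ xs → m ≤ y) →
    (even? (length (proj₁ (splitAtVal m (x ∷ xs)))) ≡ true) × UpFrom m (proj₂ (splitAtVal m (x ∷ xs)))
  up-split-at-min m x xs up mm m-min with x ≡ᵇ m in e | mm
  ... | true | _ = refl , subst (λ z → UpFrom z xs) (≡ᵇ-sound x m e) up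
  ... | false | here refl = ⊥-elim (true≢false (trans (sym (≡ᵇ-refl x)) e))
  up-split-at-min m x (y ∷ ys) (x<y , down) mm m-min | false | there mm′ =
    let (odd , after) = down-split-at-min m y ys down mm′ (λ z i → m-min z (there i))
                          (≤-<-trans (m-min x (here refl)) x<y)
    in cong not odd , after

  down-split-at-min : ∀ m x xs → DownFrom x xs → m ∈ x ∷ xs → (∀ y → y ∈ x ∷ xs → m ≤ y) → m < x →
    (even? (length (proj₁ (splitAtVal m (x ∷ xs)))) ≡ false) × UpFrom m (proj₂ (splitAtVal m (x ∷ xs)))
  down-split-at-min m x [] _ (here refl) _ m<x = ⊥-elim (<-irrefl refl m<x)
  down-split-at-min m x (y ∷ ys) (y<x , up) mm m-min m<x
    rewrite ≡ᵇ-false x m (λ e → <-irrefl (sym e) m<x) with mm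
  ... | here refl = ⊥-elim (<-irrefl refl m<x)
  ... | there mm′ =
    let (even , after) = up-split-at-min m y ys up mm′ (λ z i → m-min z (there i))
    in cong not even , after

up-down-after-min : ∀ m w → UpDown w → m ∈ w → (∀ y → y ∈ w → m ≤ y) → UpFrom m (proj₂ (splitAtVal m w))
up-down-after-min m (x ∷ xs) ud mm m-min = proj₂ (up-split-at-min m x xs ud mm m-min)

EvenCycle : List ℕ → Set
EvenCycle c = (even? (length c) ≡ true) × (0 < length c)

OddCycle : List ℕ → Set
OddCycle c = (even? (length c) ≡ false) × (0 < length c)

fFuel-[] : ∀ fuel → fFuel fuel [] ≡ []
fFuel-[] zero = refl
fFuel-[] (suc fuel) = refl

stMin-[] : ∀ fuel → stMin fuel [] ≡ 0
stMin-[] zero = refl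
stMin-[] (suc fuel) = refl

length-reverse-snoc : ∀ p (m : ℕ) → length (reverse (p ++ [ m ])) ≡ suc (length p)
length-reverse-snoc p m = trans (length-reverse (p ++ [ m ])) (trans (length-++ p) (+-comm (length p) 1))

module FirstCycle (x : ℕ) (xs : List ℕ) (nd : ND (x ∷ xs)) where
  m : ℕ
  m = minFrom x xs

  p s : List ℕ
  p = proj₁ (splitAtVal m (x ∷ xs))
  s = proj₂ (splitAtVal m (x ∷ xs))

  word≡ : x ∷ xs ≡ p ++ m ∷ s
  word≡ = splitAtVal-≡ m (x ∷ xs) (minFrom-∈ x xs)

  nd-s : ND s
  nd-s = proj₂ (ND-++ʳ p (subst ND word≡ nd))

  shorter : ∀ {fuel} → length (x ∷ xs) ≤ suc fuel → length s ≤ fuel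
  shorter le = ≤-pred (≤-trans (subst (suc (length s) ≤_) (sym (trans (cong length word≡) (length-++ p)))
                                       (m≤n+m _ (length p))) le)

  open Switch s nd-s public

  shorter-switch : ∀ {fuel} → length (x ∷ xs) ≤ suc fuel → length (switch s) ≤ fuel
  shorter-switch le = subst (_≤ _) (sym length-switch) (shorter le)

f-concat : ∀ fuel w → length w ≤ fuel → ND w → concat (fFuel fuel w) ↭ w
f-concat zero [] _ _ = ↭-refl
f-concat (suc fuel) [] _ _ = ↭-refl
f-concat (suc fuel) (x ∷ xs) le nd =
  ↭-trans (++⁺ˡ (reverse (p ++ [ m ])) (f-concat fuel (switch s) (shorter-switch le) nd-switch))
  (↭-trans (++⁺ˡ (reverse (p ++ [ m ])) switch-↭)
  (↭-trans (++⁺ʳ s (↭-reverse (p ++ [ m ])))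
   (↭-reflexive (trans (++-assoc p [ m ] s) (sym word≡)))))
  where open FirstCycle x xs nd

-- For an up-down w every cycle of f(w) has odd length: the minimum is at an
-- odd position, and switch of the (down-up) suffix is again up-down.
f-odd : ∀ fuel w → length w ≤ fuel → ND w → UpDown w → ∀ c → c ∈ fFuel fuel w → OddCycle c
f-odd (suc fuel) (x ∷ xs) le nd ud c (here refl) =
  trans (cong even? (length-reverse-snoc p m)) (cong not (proj₁ split)) ,
  subst (0 <_) (sym (length-reverse-snoc p m)) (s≤s z≤n)
  where
    open FirstCycle x xs nd
    split = up-split-at-min m x xs ud (minFrom-∈ x xs) (minFrom-≤ x xs)
f-odd (suc fuel) (x ∷ xs) le nd ud c (there cm) =
  f-odd fuel (switch s) (shorter-switch le) nd-switch
    (anti-up-down switchMap m s switchMap-anti (up-down-after-min m (x ∷ xs) ud (minFrom-∈ x xs) (minFrom-≤ x xs)))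
    c cm
  where open FirstCycle x xs nd

-- The number of cycles of f(w) is the length of the min-max subsequence of w:
-- each cycle cuts at a minimum, and switch turns the next maximum into the
-- next minimum.
mutual
  f-length : ∀ fuel fuel′ w → length w ≤ fuel → length w ≤ fuel′ → ND w → length (fFuel fuel w) ≡ stMin fuel′ w
  f-length fuel fuel′ [] _ _ _ = trans (cong length (fFuel-[] fuel)) (sym (stMin-[] fuel′))
  f-length (suc fuel) (suc fuel′) (x ∷ xs) le le′ nd =
    trans (f-length-step fuel fuel′ s nd-s (shorter le) (shorter le′)) (sym (stMin-step fuel′ x xs))
    where open FirstCycle x xs nd

  f-length-step : ∀ fuel fuel′ s → ND s → length s ≤ fuel → length s ≤ fuel′ →
    suc (length (fFuel fuel (switch s))) ≡ stepMin fuel′ s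
  f-length-step fuel fuel′ [] _ _ _ = cong suc (cong length (fFuel-[] fuel))
  f-length-step fuel fuel′ (r ∷ rs) nd le le′ = cong suc
    (trans (f-length fuel fuel′ (switch (r ∷ rs)) (subst (_≤ fuel) (sym length-switch) le)
                     (subst (_≤ fuel′) (sym length-switch) le′) nd-switch)
      (stMin-anti fuel′ switchMap (r ∷ rs) switchMap-anti))
    where open Switch (r ∷ rs) nd

gAux-concat : ∀ m cur xs → concat (gAux m cur xs) ≡ reverse cur ++ xs
gAux-concat m cur [] = refl
gAux-concat m cur (x ∷ xs) with x <ᵇ m
... | true = cong (reverse cur ++_) (gAux-concat x (x ∷ []) xs)
... | false = trans (gAux-concat m (x ∷ cur) xs)
  (trans (cong (_++ xs) (unfold-reverse x cur)) (++-assoc (reverse cur) [ x ] xs))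

g-concat : ∀ p → concat (g p) ≡ p
g-concat [] = refl
g-concat (x ∷ p) = gAux-concat x (x ∷ []) p

gAux-length : ∀ m cur xs → length (gAux m cur xs) ≡ suc (lrmFrom m xs)
gAux-length m cur [] = refl
gAux-length m cur (x ∷ xs) with x <ᵇ m
... | true = cong suc (gAux-length x (x ∷ []) xs)
... | false = gAux-length m (x ∷ cur) xs

g-length : ∀ p → length (g p) ≡ lrm p
g-length [] = refl
g-length (x ∷ p) = gAux-length x (x ∷ []) p

block-even : ∀ a rest → even? (length (a ∷ rest)) ≡ true → EvenCycle (reverse (a ∷ rest))
block-even a rest ev =
  trans (cong even? (length-reverse (a ∷ rest))) ev , subst (0 <_) (sym (length-reverse (a ∷ rest))) (s≤s z≤n)

-- Invariant:
-- the current block a ∷ rest (reversed, a its last entry) has odd length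
-- exactly when the word goes up after a; a left-to-right minimum is reached
-- by a descent, and the block before 0 ends with a descent too.
mutual
  blocks-even-up : ∀ m a rest xs s → m ≤ a → even? (length (a ∷ rest)) ≡ false → UpFrom a (xs ++ 0 ∷ s) →
    ∀ c → c ∈ gAux m (a ∷ rest) xs → EvenCycle c
  blocks-even-up m a rest [] s _ _ (() , _)
  blocks-even-up m a rest (x ∷ xs) s m≤a odd (a<x , down) c cm
    rewrite <ᵇ-false-complete {x} {m} (<⇒≤ (≤-<-trans m≤a a<x)) =
    blocks-even-down m x (a ∷ rest) xs s (cong not odd) down c cm

  blocks-even-down : ∀ m a rest xs s → even? (length (a ∷ rest)) ≡ true → DownFrom a (xs ++ 0 ∷ s) →
    ∀ c → c ∈ gAux m (a ∷ rest) xs → EvenCycle c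
  blocks-even-down m a rest [] s even _ c (here refl) = block-even a rest even
  blocks-even-down m a rest (x ∷ xs) s even (x<a , up) c cm with x <ᵇ m in e
  ... | true = new-block cm
    where
      new-block : c ∈ reverse (a ∷ rest) ∷ gAux x (x ∷ []) xs → EvenCycle c
      new-block (here refl) = block-even a rest even
      new-block (there cm′) = blocks-even-up x x [] xs s ≤-refl refl up c cm′
  ... | false = blocks-even-up m x (a ∷ rest) xs s (<ᵇ-false-sound x m e) (cong not even) up c cm

g-even : ∀ p s → UpDown (p ++ 0 ∷ s) → ∀ c → c ∈ g p → EvenCycle c
g-even (x ∷ p) s ud c cm = blocks-even-up x x [] p s ≤-refl refl ud c cm

lrmFrom-suc : ∀ m xs → lrmFrom (suc m) (map suc xs) ≡ lrmFrom m xs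
lrmFrom-suc m [] = refl
lrmFrom-suc m (x ∷ xs) with x <ᵇ m
... | true = cong suc (lrmFrom-suc x xs)
... | false = lrmFrom-suc m xs

lrm-suc : ∀ w → lrm (map suc w) ≡ lrm w
lrm-suc [] = refl
lrm-suc (x ∷ xs) = cong suc (lrmFrom-suc x xs)

lrmFrom-0 : ∀ s → lrmFrom 0 s ≡ 0
lrmFrom-0 [] = refl
lrmFrom-0 (x ∷ s) = lrmFrom-0 s

lrmFrom-mid : ∀ m q s → 0 < m → 0 ∉ q → lrmFrom m (q ++ 0 ∷ s) ≡ suc (lrmFrom m q)
lrmFrom-mid (suc m) [] s _ _ = cong suc (lrmFrom-0 s)
lrmFrom-mid m (zero ∷ q) s _ 0∉ = ⊥-elim (0∉ (here refl))
lrmFrom-mid m (suc y ∷ q) s 0<m 0∉ with suc y <ᵇ m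
... | true = cong suc (lrmFrom-mid (suc y) q s (s≤s z≤n) (λ i → 0∉ (there i)))
... | false = lrmFrom-mid m q s 0<m (λ i → 0∉ (there i))

lrm-mid : ∀ p s → 0 ∉ p → lrm (p ++ 0 ∷ s) ≡ suc (lrm p)
lrm-mid [] s _ = cong suc (lrmFrom-0 s)
lrm-mid (zero ∷ p) s 0∉ = ⊥-elim (0∉ (here refl))
lrm-mid (suc x ∷ p) s 0∉ = cong suc (lrmFrom-mid (suc x) p s (s≤s z≤n) (λ i → 0∉ (there i)))

count-parities : ∀ E O → (∀ c → c ∈ E → EvenCycle c) → (∀ c → c ∈ O → OddCycle c) →
  (countB (λ c → even? (length c)) (E ++ O) ≡ length E) ×
  (countB (λ c → not (even? (length c))) (E ++ O) ≡ length O)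
count-parities E O even odd =
  trans (countB-++ _ E O) (trans (cong₂ _+_ (countB-true _ E (λ c m → proj₁ (even c m)))
                                            (countB-false _ O (λ c m → proj₁ (odd c m))))
                                 (+-identityʳ _)) ,
  trans (countB-++ _ E O) (cong₂ _+_ (countB-false _ E (λ c m → cong not (proj₁ (even c m))))
                                     (countB-true _ O (λ c m → cong not (proj₁ (odd c m)))))

stMin-at-min : ∀ k w v → v ∈ w → (∀ y → y ∈ w → v ≤ y) → stMin (suc k) w ≡ stepMin k (proj₂ (splitAtVal v w))
stMin-at-min k (y ∷ ys) v vm v-min =
  trans (stMin-step k y ys) (cong (λ z → stepMin k (proj₂ (splitAtVal z (y ∷ ys)))) (minFrom-unique y ys v vm v-min))

stepMin-suc-switch : ∀ n s → ND s → length s ≤ n → stepMin n (map suc s) ≡ suc (length (f (switch s)))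
stepMin-suc-switch n [] _ _ = refl
stepMin-suc-switch n (r ∷ rs) nd le = cong suc (begin
  stMax n (map suc s)                            ≡⟨ sym (stMin-anti n shifted (map suc s) shifted-anti) ⟩
  stMin n (map shifted (map suc s))              ≡⟨ cong (stMin n) (map-pred-suc s) ⟩
  stMin n (switch s)                             ≡⟨ sym (f-length _ n (switch s) ≤-refl
                                                       (subst (_≤ n) (sym length-switch) le) nd-switch) ⟩
  length (f (switch s))                          ∎)
  where
    open ≡-Reasoning
    s = r ∷ rs
    open Switch s nd
    shifted : ℕ → ℕ
    shifted y = switchMap (y ∸ 1)
    shifted-anti : Anti shifted (map suc s)
    shifted-anti x y xm ym x<y with ∈-map⁻ suc xm | ∈-map⁻ suc ym
    ... | x′ , x′m , refl | y′ , y′m , refl = switchMap-anti x′ y′ x′m y′m (≤-pred x<y)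
    map-pred-suc : ∀ u → map shifted (map suc u) ≡ map switchMap u
    map-pred-suc [] = refl
    map-pred-suc (x ∷ u) = cong (switchMap x ∷_) (map-pred-suc u)

map-suc-pred : ∀ w → (∀ x → x ∈ w → 1 ≤ x) → map suc (map (λ x → x ∸ 1) w) ≡ w
map-suc-pred [] _ = refl
map-suc-pred (zero ∷ w) pos with pos zero (here refl)
... | ()
map-suc-pred (suc x ∷ w) pos = cong (suc x ∷_) (map-suc-pred w (λ y i → pos y (there i)))

module Decomposition (n : ℕ) (π : List ℕ) (perm : π ↭ oneTo (suc n)) (ud : UpDown π) where

  π′ : List ℕ
  π′ = map (λ x → x ∸ 1) π

  p s : List ℕ
  p = proj₁ (splitAtVal 0 π′)
  s = proj₂ (splitAtVal 0 π′)

  cycles : List (List ℕ)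
  cycles = g p ++ f (switch s)

  π↭range : π ↭ rangeFrom 1 (suc n)
  π↭range = subst (π ↭_) (oneTo-range (suc n)) perm

  length-π : length π ≡ suc n
  length-π = trans (↭-length π↭range) (length-range 1 (suc n))

  positive : ∀ x → x ∈ π → 1 ≤ x
  positive x xm = proj₁ (range-∈⁻ (∈-resp-↭ π↭range xm))

  π≡ : map suc π′ ≡ π
  π≡ = map-suc-pred π positive

  π′↭range : π′ ↭ 0 ∷ rangeFrom 1 n
  π′↭range = subst (π′ ↭_) (pred-range 0 (suc n)) (map⁺ (λ x → x ∸ 1) π↭range)

  0∈π′ : 0 ∈ π′
  0∈π′ = ∈-resp-↭ (↭-sym π′↭range) (here refl)

  π′≡ : π′ ≡ p ++ 0 ∷ s
  π′≡ = splitAtVal-≡ 0 π′ 0∈π′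

  nd-s : ND s
  nd-s = proj₂ (ND-++ʳ p (subst ND π′≡ (ND-↭ (↭-sym π′↭range) (ND-range 0 (suc n)))))

  ud′ : UpDown π′
  ud′ = up-down-pred π′ (subst UpDown (sym π≡) ud)

  length-s : length s ≤ n
  length-s = ≤-pred (subst (suc (length s) ≤_) length-π′ (m≤n+m _ (length p)))
    where
      length-π′ : length p + length (0 ∷ s) ≡ suc n
      length-π′ = begin
        length p + length (0 ∷ s)  ≡⟨ sym (length-++ p) ⟩
        length (p ++ 0 ∷ s)        ≡⟨ cong length (sym π′≡) ⟩
        length π′                  ≡⟨ length-map _ π ⟩
        length π                   ≡⟨ length-π ⟩
        suc n                      ∎
        where open ≡-Reasoning

  cover : concat cycles ↭ oneTo n
  cover = subst (concat cycles ↭_) (sym (oneTo-range n))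
    (↭-trans (↭-reflexive (trans (sym (concat-++ (g p) (f (switch s))))
                                 (cong (_++ concat (f (switch s))) (g-concat p))))
    (↭-trans (++⁺ˡ p (f-concat _ (switch s) ≤-refl nd-switch))
    (↭-trans (++⁺ˡ p switch-↭) (drop-mid p [] (subst (_↭ 0 ∷ rangeFrom 1 n) π′≡ π′↭range)))))
    where open Switch s nd-s

  even-g : ∀ c → c ∈ g p → EvenCycle c
  even-g = g-even p s (subst UpDown π′≡ ud′)

  odd-f : ∀ c → c ∈ f (switch s) → OddCycle c
  odd-f = f-odd _ (switch s) ≤-refl nd-switch
            (anti-up-down switchMap 0 s switchMap-anti (up-down-after-min 0 π′ ud′ 0∈π′ (λ _ _ → z≤n)))
    where open Switch s nd-s

  nonempty : ∀ c → c ∈ cycles → 0 < length c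
  nonempty c cm with ∈-++⁻ (g p) cm
  ... | inj₁ m = proj₂ (even-g c m)
  ... | inj₂ m = proj₂ (odd-f c m)

  lrm-π : lrm π ≡ suc (length (g p))
  lrm-π = begin
    lrm π                ≡⟨ cong lrm (sym π≡) ⟩
    lrm (map suc π′)     ≡⟨ lrm-suc π′ ⟩
    lrm π′               ≡⟨ cong lrm π′≡ ⟩
    lrm (p ++ 0 ∷ s)     ≡⟨ lrm-mid p s (splitAtVal-prefix-∉ 0 π′) ⟩
    suc (lrm p)          ≡⟨ cong suc (sym (g-length p)) ⟩
    suc (length (g p))   ∎
    where open ≡-Reasoning

  st-π : st π ≡ suc (length (f (switch s)))
  st-π = begin
    stMin (length π) π                              ≡⟨ cong (λ k → stMin k π) length-π ⟩
    stMin (suc n) π                                 ≡⟨ stMin-at-min n π 1 1∈π positive ⟩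
    stepMin n (proj₂ (splitAtVal 1 π))              ≡⟨ cong (λ w → stepMin n (proj₂ (splitAtVal 1 w))) (sym π≡) ⟩
    stepMin n (proj₂ (splitAtVal 1 (map suc π′)))   ≡⟨ cong (λ q → stepMin n (proj₂ q))
                                                         (splitAtVal-map suc 0 π′ (λ _ _ _ _ → suc-injective) 0∈π′) ⟩
    stepMin n (map suc s)                           ≡⟨ stepMin-suc-switch n s nd-s length-s ⟩
    suc (length (f (switch s)))                     ∎
    where
      open ≡-Reasoning
      1∈π : 1 ∈ π
      1∈π = ∈-resp-↭ (↭-sym π↭range) (here refl)

proposition4p3 : (n : ℕ) (π : List ℕ) → π ↭ oneTo (suc n) → UpDown π →
    (cycE n (φ π) ≡ lrm π ∸ 1)
    × (cycO n (φ π) ≡ st π ∸ 1)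
    × (cyc n (φ π) ≡ lrm π + st π ∸ 2)
proposition4p3 n π perm ud = even-cycles , odd-cycles , all-cycles
  where
    open Decomposition n π perm ud
    open CycleProduct n cycles cover nonempty
    parities : (countB (λ c → even? (length c)) cycles ≡ length (g p))
             × (countB (λ c → not (even? (length c))) cycles ≡ length (f (switch s)))
    parities = count-parities (g p) (f (switch s)) even-g odd-f

    even-cycles : cycE n (φ π) ≡ lrm π ∸ 1
    even-cycles = trans cycE-count (trans (proj₁ parities) (cong (_∸ 1) (sym lrm-π)))

    odd-cycles : cycO n (φ π) ≡ st π ∸ 1
    odd-cycles = trans cycO-count (trans (proj₂ parities) (cong (_∸ 1) (sym st-π)))

    all-cycles : cyc n (φ π) ≡ lrm π + st π ∸ 2
    all-cycles = trans cyc-count (trans (length-++ (g p))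
      (sym (trans (cong₂ (λ a b → a + b ∸ 2) lrm-π st-π) (cong (_∸ 1) (+-suc (length (g p)) _)))))
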